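{- The Lipschitz order $\mathbb{Z}[i,j]$ and the Hurwitz order $\mathcal{O}_3=\mathbb{Z}[i,j,(1+i+j+ij)/2]$ in $\left(\frac{ -1,-1}{\mathbb{Q}}\right)$ are Clifford-Euclidean for the norm $N(x)=x\bar x$.
   Context: $\left(\frac{ -1,-1}{\mathbb{Q}}\right)=\mathbb{Q}[i,j]$, $i^2=j^2=-1$, $ij=-ji$; $\mathbb{Z}[i,j]$ is the $\mathbb{Z}$-span of $1,i,j,ij$. Involutions: parity $x'$ ($i\mapsto-i,j\mapsto-j$), transpose $x^*$ (anti-automorphism fixing $i,j$), $\bar x=(x')^*$ (quaternion conjugation). Clifford vectors $\operatorname{Vec}=\mathbb{Q}+\mathbb{Q}i+\mathbb{Q}j$; $\operatorname{Vec}(R)=R\cap\operatorname{Vec}$. Clifford monoid $R^{\mathrm{mon}}=\{x\in R: x\bar x\in\mathbb{Q},\ x\operatorname{Vec}x^*\subseteq\operatorname{Vec}\}$. A $*$-stable order $R$ is right Clifford-Euclidean for $N$ if $N(x)=0$ iff $x$ is a zero-divisor and for all $x,y\in R^{\mathrm{mon}}$ with $N(x)>0$ and $xy^*\in\operatorname{Vec}(R)$ there exist $q\in\operatorname{Vec}(R)$, $r\in R^{\mathrm{mon}}$ with $y=xq+r$, $N(r)<N(x)$; left symmetric; Clifford-Euclidean means right or left. -}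

module Defs where

open import Data.Rational using (ℚ; 0ℚ; 1ℚ; _+_; _*_; -_; _<_; _/_)
open import Data.Integer using (ℤ)
open import Data.Product using (Σ; ∃; _×_; _,_)
open import Data.Sum using (_⊎_)
open import Relation.Binary.PropositionalEquality using (_≡_)
open import Relation.Nullary using (¬_)
open import Function.Bundles using (_⇔_)

-- Elements of the quaternion algebra (-1,-1 / ℚ) = ℚ[i,j], written
-- a + b i + c j + d (ij), with i² = j² = -1, ij = -ji.
record Quat : Set where
  constructor quat
  field
    re : ℚ
    ci : ℚ
    cj : ℚ
    ck : ℚ

open Quat public

infixl 6 _+Q_
infixl 7 _*Q_

_+Q_ : Quat → Quat → Quat
quat a b c d +Q quat a' b' c' d' = quat (a + a') (b + b') (c + c') (d + d')

-- multiplication with i² = j² = (ij)² = -1, ij = -ji (Hamilton rules, k = ij)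
_*Q_ : Quat → Quat → Quat
quat a b c d *Q quat a' b' c' d' =
  quat (a * a' + - (b * b') + - (c * c') + - (d * d'))
       (a * b' + b * a' + c * d' + - (d * c'))
       (a * c' + - (b * d') + c * a' + d * b')
       (a * d' + b * c' + - (c * b') + d * a')

0Q : Quat
0Q = quat 0ℚ 0ℚ 0ℚ 0ℚ

scalar : ℚ → Quat
scalar q = quat q 0ℚ 0ℚ 0ℚ

-- parity x' : i ↦ -i, j ↦ -j  (hence ij ↦ ij)
parity : Quat → Quat
parity (quat a b c d) = quat a (- b) (- c) d

-- transpose x* : anti-automorphism fixing i, j  (hence ij ↦ ji = -ij)
transpose : Quat → Quat
transpose (quat a b c d) = quat a b c (- d)

conj : Quat → Quat
conj x = transpose (parity x)

InQ : Quat → Set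
InQ x = x ≡ scalar (re x)

N : Quat → ℚ
N x = re (x *Q conj x)

IsVec : Quat → Set
IsVec x = ck x ≡ 0ℚ

Subset : Set₁
Subset = Quat → Set

VecOf : Subset → Subset
VecOf R x = R x × IsVec x

Mon : Subset → Subset
Mon R x = R x × InQ (x *Q conj x) × ((v : Quat) → IsVec v → IsVec (x *Q v *Q transpose x))

ZeroDivisor : Subset → Quat → Set
ZeroDivisor R x = Σ Quat λ y → R y × ¬ (y ≡ 0Q) × ((x *Q y ≡ 0Q) ⊎ (y *Q x ≡ 0Q))

RightCliffordEuclidean : Subset → (Quat → ℚ) → Set
RightCliffordEuclidean R n =
  ((x : Quat) → R x → (n x ≡ 0ℚ ⇔ ZeroDivisor R x)) ×
  ((x y : Quat) → Mon R x → Mon R y → 0ℚ < n x → VecOf R (x *Q transpose y) →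
     Σ Quat λ q → Σ Quat λ r → VecOf R q × Mon R r × (y ≡ x *Q q +Q r) × (n r < n x))

LeftCliffordEuclidean : Subset → (Quat → ℚ) → Set
LeftCliffordEuclidean R n =
  ((x : Quat) → R x → (n x ≡ 0ℚ ⇔ ZeroDivisor R x)) ×
  ((x y : Quat) → Mon R x → Mon R y → 0ℚ < n x → VecOf R (transpose y *Q x) →
     Σ Quat λ q → Σ Quat λ r → VecOf R q × Mon R r × (y ≡ q *Q x +Q r) × (n r < n x))

CliffordEuclidean : Subset → (Quat → ℚ) → Set
CliffordEuclidean R n = RightCliffordEuclidean R n ⊎ LeftCliffordEuclidean R n

ZSpan : Quat → Quat → Quat → Quat → Subset
ZSpan e₁ e₂ e₃ e₄ x =
  Σ ℤ λ a → Σ ℤ λ b → Σ ℤ λ c → Σ ℤ λ d →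
    x ≡ scalar (a / 1) *Q e₁ +Q scalar (b / 1) *Q e₂ +Q scalar (c / 1) *Q e₃ +Q scalar (d / 1) *Q e₄

qi qj qij : Quat
qi  = quat 0ℚ 1ℚ 0ℚ 0ℚ
qj  = quat 0ℚ 0ℚ 1ℚ 0ℚ
qij = quat 0ℚ 0ℚ 0ℚ 1ℚ

hurwitzGen : Quat
hurwitzGen = quat h h h h where
  h : ℚ
  h = Data.Rational.½

Lipschitz : Subset
Lipschitz = ZSpan (scalar 1ℚ) qi qj qij

Hurwitz : Subset
Hurwitz = ZSpan (scalar 1ℚ) qi qj hurwitzGen

{-# OPTIONS --safe #-}
module Submission where

-- Both orders are s·L for a lattice L ⊆ ℤ⁴ of integral coordinates: s = 1 and L = ℤ⁴
-- for ℤ[i,j], s = ½ and L spanned by 2, 2i, 2j, 1+i+j+ij for O₃; then N(s·X) = s²·N(X).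
-- The norm is anisotropic, so the zero divisors are exactly the elements of norm 0, and
-- every quaternion satisfies the two Clifford monoid conditions. For the division, if xy*
-- is a vector then X̄Y has no ij-part; rounding its other three coordinates to multiples of
-- m = N(X) gives a vector q ∈ ℤ[i,j] with X̄(Y − Xq) = X̄Y − mq of ij-part 0 and other
-- coordinates of size at most m/2, so m·N(Y − Xq) ≤ 3m²/4 < m². The remainder y − xq stays
-- in the order because L is closed under Y ↦ Y − Xq.

open import Defs
open import Level using (0ℓ)
open import Algebra.Bundles.Raw using (RawRing)
open import Tactic.RingSolver.Core.AlmostCommutativeRing using (AlmostCommutativeRing; fromCommutativeRing)
import Tactic.RingSolver.NonReflective as NonReflective
open import Tactic.RingSolver using (solve-∀)
open import Data.Nat as ℕ using (ℕ; NonZero; _≤_; _<_; suc)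
import Data.Nat.Properties as ℕP
import Data.Nat.Tactic.RingSolver as ℕSolver
open import Data.Integer as ℤ using (ℤ; +_; 0ℤ; 1ℤ; ∣_∣; _⊖_; -[1+_])
import Data.Integer.Properties as ℤP
open import Data.Integer.DivMod using (_/ℕ_; _%ℕ_; a≡a%ℕn+[a/ℕn]*n; n%ℕd<d)
import Data.Integer.Tactic.RingSolver as ℤSolver
open import Data.Rational as ℚ using (ℚ; 0ℚ; 1ℚ; ½; _/_; toℚᵘ; Positive)
import Data.Rational.Properties as ℚP
open import Data.Rational.Unnormalised as ℚᵘ using (mkℚᵘ; *≡*; *<*) renaming (_≃_ to _≃ᵘ_)
import Data.Rational.Unnormalised.Properties as ℚᵘP
open import Data.Product using (Σ; ∃; _×_; _,_; proj₁; proj₂)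
open import Data.Sum as Sum using (_⊎_; inj₁; inj₂)
open import Data.Empty using (⊥-elim)
open import Function using (id; _∘_)
open import Function.Bundles using (_⇔_; mk⇔)
open import Relation.Nullary using (yes; no)
open import Relation.Nullary.Decidable.Core using (dec⇒maybe)
open import Relation.Binary.PropositionalEquality

record Quaternion (A : Set) : Set where
  constructor ⟨_,_,_,_⟩
  field
    re′ ci′ cj′ ck′ : A

open Quaternion public

quaternion-ext : ∀ {A : Set} {a b c d a′ b′ c′ d′ : A} →
  a ≡ a′ → b ≡ b′ → c ≡ c′ → d ≡ d′ → ⟨ a , b , c , d ⟩ ≡ ⟨ a′ , b′ , c′ , d′ ⟩
quaternion-ext refl refl refl refl = refl

module QuaternionArithmetic (R : RawRing 0ℓ 0ℓ) where
  open RawRing R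

  infixl 6 _+ᴴ_ _-ᴴ_
  infixl 7 _*ᴴ_ _·ᴴ_

  _+ᴴ_ _-ᴴ_ _*ᴴ_ : Quaternion Carrier → Quaternion Carrier → Quaternion Carrier
  ⟨ a , b , c , d ⟩ +ᴴ ⟨ e , f , g , h ⟩ = ⟨ a + e , b + f , c + g , d + h ⟩
  ⟨ a , b , c , d ⟩ -ᴴ ⟨ e , f , g , h ⟩ = ⟨ a + - e , b + - f , c + - g , d + - h ⟩
  ⟨ a , b , c , d ⟩ *ᴴ ⟨ e , f , g , h ⟩ =
    ⟨ a * e + - (b * f) + - (c * g) + - (d * h)
    , a * f + b * e + c * h + - (d * g)
    , a * g + - (b * h) + c * e + d * f
    , a * h + b * g + - (c * f) + d * e ⟩

  _·ᴴ_ : Carrier → Quaternion Carrier → Quaternion Carrier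
  n ·ᴴ ⟨ a , b , c , d ⟩ = ⟨ n * a , n * b , n * c , n * d ⟩

  conjᴴ transposeᴴ : Quaternion Carrier → Quaternion Carrier
  conjᴴ ⟨ a , b , c , d ⟩ = ⟨ a , - b , - c , - d ⟩
  transposeᴴ ⟨ a , b , c , d ⟩ = ⟨ a , b , c , - d ⟩

  Nᴴ : Quaternion Carrier → Carrier
  Nᴴ ⟨ a , b , c , d ⟩ = a * a + b * b + c * c + d * d

  scalarᴴ : Carrier → Quaternion Carrier
  scalarᴴ a = ⟨ a , 0# , 0# , 0# ⟩

  0ᴴ 1ᴴ iᴴ jᴴ kᴴ ωᴴ : Quaternion Carrier
  0ᴴ = scalarᴴ 0#
  1ᴴ = scalarᴴ 1#
  iᴴ = ⟨ 0# , 1# , 0# , 0# ⟩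
  jᴴ = ⟨ 0# , 0# , 1# , 0# ⟩
  kᴴ = ⟨ 0# , 0# , 0# , 1# ⟩
  ωᴴ = ⟨ 1# , 1# , 1# , 1# ⟩

  combinationᴴ : (E₁ E₂ E₃ E₄ : Quaternion Carrier) → Quaternion Carrier → Quaternion Carrier
  combinationᴴ E₁ E₂ E₃ E₄ ⟨ a , b , c , d ⟩ =
    scalarᴴ a *ᴴ E₁ +ᴴ scalarᴴ b *ᴴ E₂ +ᴴ scalarᴴ c *ᴴ E₃ +ᴴ scalarᴴ d *ᴴ E₄

  -- ω = 1 + i + j + ij; coordinates in the Hurwitz basis 1, i, j, ω/2 are doubled so that they stay integral.
  lipschitzᴴ hurwitzᴴ : Quaternion Carrier → Quaternion Carrier
  lipschitzᴴ = combinationᴴ 1ᴴ iᴴ jᴴ kᴴ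
  hurwitzᴴ = combinationᴴ (1ᴴ +ᴴ 1ᴴ) (iᴴ +ᴴ iᴴ) (jᴴ +ᴴ jᴴ) ωᴴ

  lipschitz⇒hurwitzᴴ : Quaternion Carrier → Quaternion Carrier
  lipschitz⇒hurwitzᴴ ⟨ a , b , c , d ⟩ = ⟨ a + - d , b + - d , c + - d , d + d ⟩

  -- The Hurwitz coefficients of x·q for x with Hurwitz coefficients ⟨ a , b , c , d ⟩ and a vector q.
  hurwitz-*-vectorᴴ : Quaternion Carrier → Quaternion Carrier → Quaternion Carrier
  hurwitz-*-vectorᴴ ⟨ a , b , c , d ⟩ ⟨ p , q , r , _ ⟩ =
    ⟨ p * a + q * (c + - b) + r * (- b + - c + - d)
    , p * b + q * (a + c + d) + r * (- b + - d)
    , p * c + q * (c + d) + r * (a + - b)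
    , p * d + q * (- c + - c + - d) + r * (b + b + d) ⟩

-- Instantiating the arithmetic at the solver's expressions makes every quaternion
-- identity a polynomial identity that `solve` checks componentwise.
module QuaternionSolver (R : AlmostCommutativeRing 0ℓ 0ℓ) where
  open AlmostCommutativeRing R using (Carrier; 0#; 1#)
  open NonReflective R public using (solve; _⊜_; Expr; Κ; _⊕_; _⊗_; ⊝_)

  expressionRing : ℕ → RawRing 0ℓ 0ℓ
  expressionRing n = record
    { Carrier = Expr Carrier n ; _≈_ = _≡_ ; _+_ = _⊕_ ; _*_ = _⊗_ ; -_ = ⊝_ ; 0# = Κ 0# ; 1# = Κ 1# }

  open module Expressions {n} = QuaternionArithmetic (expressionRing n) public

module ℤ-QuaternionSolver = QuaternionSolver ℤSolver.ring

ℤQuat : Set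
ℤQuat = Quaternion ℤ

open QuaternionArithmetic ℤ.+-*-rawRing public renaming
  ( _+ᴴ_ to _+ᶻ_ ; _-ᴴ_ to _-ᶻ_ ; _*ᴴ_ to _*ᶻ_ ; _·ᴴ_ to _·ᶻ_ ; conjᴴ to conjᶻ ; transposeᴴ to transposeᶻ
  ; Nᴴ to Nᶻ ; scalarᴴ to scalarᶻ ; 0ᴴ to 0ᶻ ; 1ᴴ to 1ᶻ ; iᴴ to iᶻ ; jᴴ to jᶻ ; kᴴ to kᶻ ; ωᴴ to ωᶻ
  ; combinationᴴ to combinationᶻ ; lipschitzᴴ to lipschitzᶻ ; hurwitzᴴ to hurwitzᶻ
  ; lipschitz⇒hurwitzᴴ to lipschitz⇒hurwitzᶻ ; hurwitz-*-vectorᴴ to hurwitz-*-vectorᶻ )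

Nℕ : ℤQuat → ℕ
Nℕ ⟨ a , b , c , d ⟩ = ∣ a ∣ ℕ.* ∣ a ∣ ℕ.+ ∣ b ∣ ℕ.* ∣ b ∣ ℕ.+ ∣ c ∣ ℕ.* ∣ c ∣ ℕ.+ ∣ d ∣ ℕ.* ∣ d ∣

i*i≡+∣i∣*∣i∣ : ∀ i → i ℤ.* i ≡ + (∣ i ∣ ℕ.* ∣ i ∣)
i*i≡+∣i∣*∣i∣ (+ n)    = sym (ℤP.pos-* n n)
i*i≡+∣i∣*∣i∣ -[1+ n ] = refl

Nᶻ≡+Nℕ : ∀ X → Nᶻ X ≡ + Nℕ X
Nᶻ≡+Nℕ ⟨ a , b , c , d ⟩ = begin
  a ℤ.* a ℤ.+ b ℤ.* b ℤ.+ c ℤ.* c ℤ.+ d ℤ.* d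
    ≡⟨ cong₂ ℤ._+_ (cong₂ ℤ._+_ (cong₂ ℤ._+_ (i*i≡+∣i∣*∣i∣ a) (i*i≡+∣i∣*∣i∣ b)) (i*i≡+∣i∣*∣i∣ c)) (i*i≡+∣i∣*∣i∣ d) ⟩
  + A ℤ.+ + B ℤ.+ + C ℤ.+ + D  ≡⟨ cong (λ n → n ℤ.+ + C ℤ.+ + D) (ℤP.pos-+ A B) ⟨
  + (A ℕ.+ B) ℤ.+ + C ℤ.+ + D  ≡⟨ cong (ℤ._+ + D) (ℤP.pos-+ (A ℕ.+ B) C) ⟨
  + (A ℕ.+ B ℕ.+ C) ℤ.+ + D    ≡⟨ ℤP.pos-+ (A ℕ.+ B ℕ.+ C) D ⟨
  + (A ℕ.+ B ℕ.+ C ℕ.+ D)      ∎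
  where
  open ≡-Reasoning
  A B C D : ℕ
  A = ∣ a ∣ ℕ.* ∣ a ∣
  B = ∣ b ∣ ℕ.* ∣ b ∣
  C = ∣ c ∣ ℕ.* ∣ c ∣
  D = ∣ d ∣ ℕ.* ∣ d ∣

Nᶻ-*ᶻ : ∀ X Y → Nᶻ (X *ᶻ Y) ≡ Nᶻ X ℤ.* Nᶻ Y
Nᶻ-*ᶻ ⟨ a , b , c , d ⟩ ⟨ e , f , g , h ⟩ =
  solve 8 (λ a b c d e f g h → Nᴴ (⟨ a , b , c , d ⟩ *ᴴ ⟨ e , f , g , h ⟩) ⊜ Nᴴ ⟨ a , b , c , d ⟩ ⊗ Nᴴ ⟨ e , f , g , h ⟩)
    refl a b c d e f g h
  where open ℤ-QuaternionSolver

Nℕ-*ᶻ : ∀ X Y → Nℕ (X *ᶻ Y) ≡ Nℕ X ℕ.* Nℕ Y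
Nℕ-*ᶻ X Y = ℤP.+-injective (begin
  + Nℕ (X *ᶻ Y)      ≡⟨ Nᶻ≡+Nℕ (X *ᶻ Y) ⟨
  Nᶻ (X *ᶻ Y)        ≡⟨ Nᶻ-*ᶻ X Y ⟩
  Nᶻ X ℤ.* Nᶻ Y      ≡⟨ cong₂ ℤ._*_ (Nᶻ≡+Nℕ X) (Nᶻ≡+Nℕ Y) ⟩
  + Nℕ X ℤ.* + Nℕ Y  ≡⟨ ℤP.pos-* (Nℕ X) (Nℕ Y) ⟨
  + (Nℕ X ℕ.* Nℕ Y)  ∎)
  where open ≡-Reasoning

Nℕ-conjᶻ : ∀ X → Nℕ (conjᶻ X) ≡ Nℕ X
Nℕ-conjᶻ ⟨ a , b , c , d ⟩
  rewrite ℤP.∣-i∣≡∣i∣ b | ℤP.∣-i∣≡∣i∣ c | ℤP.∣-i∣≡∣i∣ d = refl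

Nℕ-vector : ∀ E → ck′ E ≡ 0ℤ → Nℕ E ≡ ∣ re′ E ∣ ℕ.* ∣ re′ E ∣ ℕ.+ ∣ ci′ E ∣ ℕ.* ∣ ci′ E ∣ ℕ.+ ∣ cj′ E ∣ ℕ.* ∣ cj′ E ∣
Nℕ-vector ⟨ a , b , c , _ ⟩ refl = ℕP.+-identityʳ _

∣i∣*∣i∣≡0⇒i≡0 : ∀ i → ∣ i ∣ ℕ.* ∣ i ∣ ≡ 0 → i ≡ 0ℤ
∣i∣*∣i∣≡0⇒i≡0 i eq = ℤP.∣i∣≡0⇒i≡0 (Sum.[ id , id ]′ (ℕP.m*n≡0⇒m≡0∨n≡0 ∣ i ∣ eq))

Nℕ≡0⇒≡0ᶻ : ∀ X → Nℕ X ≡ 0 → X ≡ 0ᶻ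
Nℕ≡0⇒≡0ᶻ ⟨ a , b , c , d ⟩ eq = quaternion-ext
  (∣i∣*∣i∣≡0⇒i≡0 a (ℕP.m+n≡0⇒m≡0 _ ab≡0)) (∣i∣*∣i∣≡0⇒i≡0 b (ℕP.m+n≡0⇒n≡0 _ ab≡0))
  (∣i∣*∣i∣≡0⇒i≡0 c (ℕP.m+n≡0⇒n≡0 _ abc≡0)) (∣i∣*∣i∣≡0⇒i≡0 d (ℕP.m+n≡0⇒n≡0 _ eq))
  where
  abc≡0 : ∣ a ∣ ℕ.* ∣ a ∣ ℕ.+ ∣ b ∣ ℕ.* ∣ b ∣ ℕ.+ ∣ c ∣ ℕ.* ∣ c ∣ ≡ 0
  abc≡0 = ℕP.m+n≡0⇒m≡0 _ eq
  ab≡0 : ∣ a ∣ ℕ.* ∣ a ∣ ℕ.+ ∣ b ∣ ℕ.* ∣ b ∣ ≡ 0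
  ab≡0 = ℕP.m+n≡0⇒m≡0 _ abc≡0

*ᶻ≡0ᶻ⇒≡0ᶻ : ∀ X Y → X *ᶻ Y ≡ 0ᶻ → X ≡ 0ᶻ ⊎ Y ≡ 0ᶻ
*ᶻ≡0ᶻ⇒≡0ᶻ X Y XY≡0 = Sum.map (Nℕ≡0⇒≡0ᶻ X) (Nℕ≡0⇒≡0ᶻ Y) (ℕP.m*n≡0⇒m≡0∨n≡0 (Nℕ X) NX*NY≡0)
  where
  NX*NY≡0 : Nℕ X ℕ.* Nℕ Y ≡ 0
  NX*NY≡0 = trans (sym (Nℕ-*ᶻ X Y)) (cong Nℕ XY≡0)

X+ᶻ[Y-ᶻX]≡Y : ∀ X Y → X +ᶻ (Y -ᶻ X) ≡ Y
X+ᶻ[Y-ᶻX]≡Y ⟨ a , b , c , d ⟩ ⟨ e , f , g , h ⟩ = quaternion-ext (cancel a e) (cancel b f) (cancel c g) (cancel d h)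
  where
  cancel : ∀ a e → a ℤ.+ (e ℤ.+ ℤ.- a) ≡ e
  cancel = ℤSolver.solve-∀

-- Division with a vector quotient

ck′-conjᶻ-*ᶻ : ∀ X Y → ck′ (conjᶻ X *ᶻ Y) ≡ ℤ.- ck′ (X *ᶻ transposeᶻ Y)
ck′-conjᶻ-*ᶻ ⟨ a , b , c , d ⟩ ⟨ e , f , g , h ⟩ =
  solve 8 (λ a b c d e f g h → ck′ (conjᴴ ⟨ a , b , c , d ⟩ *ᴴ ⟨ e , f , g , h ⟩)
                             ⊜ ⊝ ck′ (⟨ a , b , c , d ⟩ *ᴴ transposeᴴ ⟨ e , f , g , h ⟩))
    refl a b c d e f g h
  where open ℤ-QuaternionSolver

conjᶻ-*ᶻ-remainder : ∀ X Y Q → conjᶻ X *ᶻ (Y -ᶻ X *ᶻ Q) ≡ conjᶻ X *ᶻ Y -ᶻ Nᶻ X ·ᶻ Q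
conjᶻ-*ᶻ-remainder ⟨ a , b , c , d ⟩ ⟨ e , f , g , h ⟩ ⟨ p , q , r , t ⟩ = quaternion-ext
  (solve 12 (λ a b c d e f g h p q r t → re′ (lhs a b c d e f g h p q r t) ⊜ re′ (rhs a b c d e f g h p q r t))
     refl a b c d e f g h p q r t)
  (solve 12 (λ a b c d e f g h p q r t → ci′ (lhs a b c d e f g h p q r t) ⊜ ci′ (rhs a b c d e f g h p q r t))
     refl a b c d e f g h p q r t)
  (solve 12 (λ a b c d e f g h p q r t → cj′ (lhs a b c d e f g h p q r t) ⊜ cj′ (rhs a b c d e f g h p q r t))
     refl a b c d e f g h p q r t)
  (solve 12 (λ a b c d e f g h p q r t → ck′ (lhs a b c d e f g h p q r t) ⊜ ck′ (rhs a b c d e f g h p q r t))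
     refl a b c d e f g h p q r t)
  where
  open ℤ-QuaternionSolver
  lhs rhs : ∀ {n} (a b c d e f g h p q r t : Expr ℤ n) → Quaternion (Expr ℤ n)
  lhs a b c d e f g h p q r t = conjᴴ ⟨ a , b , c , d ⟩ *ᴴ (⟨ e , f , g , h ⟩ -ᴴ ⟨ a , b , c , d ⟩ *ᴴ ⟨ p , q , r , t ⟩)
  rhs a b c d e f g h p q r t = conjᴴ ⟨ a , b , c , d ⟩ *ᴴ ⟨ e , f , g , h ⟩ -ᴴ Nᴴ ⟨ a , b , c , d ⟩ ·ᴴ ⟨ p , q , r , t ⟩

nearestMultiple-remainder : ∀ r m → r < m → ∃ λ t → ∣ + r ℤ.- + m ℤ.* t ∣ ℕ.+ ∣ + r ℤ.- + m ℤ.* t ∣ ≤ m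
nearestMultiple-remainder r m r<m with r ℕ.+ r ℕ.≤? m
... | yes r+r≤m = 0ℤ , subst (λ e → ∣ e ∣ ℕ.+ ∣ e ∣ ≤ m) (sym r-m*0≡r) r+r≤m
  where
  r-m*0≡r : + r ℤ.- + m ℤ.* 0ℤ ≡ + r
  r-m*0≡r = trans (cong (λ e → + r ℤ.- e) (ℤP.*-zeroʳ (+ m))) (ℤP.+-identityʳ (+ r))
... | no r+r≰m = 1ℤ , subst (λ k → k ℕ.+ k ≤ m) (sym ∣r-m∣≡m∸r) (begin
    (m ℕ.∸ r) ℕ.+ (m ℕ.∸ r)  ≤⟨ ℕP.+-monoʳ-≤ (m ℕ.∸ r) (ℕP.m≤n+o⇒m∸n≤o m r (ℕP.<⇒≤ (ℕP.≰⇒> r+r≰m))) ⟩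
    (m ℕ.∸ r) ℕ.+ r          ≡⟨ ℕP.m∸n+n≡m (ℕP.<⇒≤ r<m) ⟩
    m                        ∎)
  where
  open ℕP.≤-Reasoning
  ∣r-m∣≡m∸r : ∣ + r ℤ.- + m ℤ.* 1ℤ ∣ ≡ m ℕ.∸ r
  ∣r-m∣≡m∸r = begin-equality
    ∣ + r ℤ.- + m ℤ.* 1ℤ ∣  ≡⟨ cong (λ e → ∣ + r ℤ.- e ∣) (ℤP.*-identityʳ (+ m)) ⟩
    ∣ + r ℤ.- + m ∣         ≡⟨ cong ∣_∣ (ℤP.m-n≡m⊖n r m) ⟩
    ∣ r ⊖ m ∣               ≡⟨ ℤP.∣⊖∣-< r<m ⟩
    m ℕ.∸ r                 ∎

nearestMultiple : ∀ z m .{{_ : NonZero m}} → ∃ λ q → ∣ z ℤ.- + m ℤ.* q ∣ ℕ.+ ∣ z ℤ.- + m ℤ.* q ∣ ≤ m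
nearestMultiple z m with nearestMultiple-remainder (z %ℕ m) m (n%ℕd<d z m)
... | t , bound = z /ℕ m ℤ.+ t , subst (λ e → ∣ e ∣ ℕ.+ ∣ e ∣ ≤ m) shift bound
  where
  open ≡-Reasoning
  regroup : ∀ r q m t → r ℤ.- m ℤ.* t ≡ r ℤ.+ q ℤ.* m ℤ.- m ℤ.* (q ℤ.+ t)
  regroup = ℤSolver.solve-∀
  shift : + (z %ℕ m) ℤ.- + m ℤ.* t ≡ z ℤ.- + m ℤ.* (z /ℕ m ℤ.+ t)
  shift = begin
    + (z %ℕ m) ℤ.- + m ℤ.* t                                ≡⟨ regroup (+ (z %ℕ m)) (z /ℕ m) (+ m) t ⟩
    + (z %ℕ m) ℤ.+ z /ℕ m ℤ.* + m ℤ.- + m ℤ.* (z /ℕ m ℤ.+ t) ≡⟨ cong (ℤ._- + m ℤ.* (z /ℕ m ℤ.+ t)) (a≡a%ℕn+[a/ℕn]*n z m) ⟨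
    z ℤ.- + m ℤ.* (z /ℕ m ℤ.+ t)                             ∎

m*w≡sum-of-three-squares⇒w<m : ∀ {m w a b c} .{{_ : NonZero m}} → m ℕ.* w ≡ a ℕ.* a ℕ.+ b ℕ.* b ℕ.+ c ℕ.* c →
  a ℕ.+ a ≤ m → b ℕ.+ b ≤ m → c ℕ.+ c ≤ m → w < m
m*w≡sum-of-three-squares⇒w<m {m@(suc _)} {w} {a} {b} {c} m*w≡ 2a≤m 2b≤m 2c≤m =
  ℕP.*-cancelˡ-< (4 ℕ.* m) w m (begin-strict
    4 ℕ.* m ℕ.* w
      ≡⟨ trans (ℕP.*-assoc 4 m w) (trans (cong (4 ℕ.*_) m*w≡) (quadruple a b c)) ⟩
    (a ℕ.+ a) ℕ.* (a ℕ.+ a) ℕ.+ (b ℕ.+ b) ℕ.* (b ℕ.+ b) ℕ.+ (c ℕ.+ c) ℕ.* (c ℕ.+ c)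
      ≤⟨ ℕP.+-mono-≤ (ℕP.+-mono-≤ (ℕP.*-mono-≤ 2a≤m 2a≤m) (ℕP.*-mono-≤ 2b≤m 2b≤m)) (ℕP.*-mono-≤ 2c≤m 2c≤m) ⟩
    m ℕ.* m ℕ.+ m ℕ.* m ℕ.+ m ℕ.* m
      <⟨ ℕP.m<m+n _ ℕ.z<s ⟩
    m ℕ.* m ℕ.+ m ℕ.* m ℕ.+ m ℕ.* m ℕ.+ m ℕ.* m
      ≡⟨ quadruple-square m ⟩
    4 ℕ.* m ℕ.* m ∎)
  where
  open ℕP.≤-Reasoning
  quadruple : ∀ a b c → 4 ℕ.* (a ℕ.* a ℕ.+ b ℕ.* b ℕ.+ c ℕ.* c) ≡
    (a ℕ.+ a) ℕ.* (a ℕ.+ a) ℕ.+ (b ℕ.+ b) ℕ.* (b ℕ.+ b) ℕ.+ (c ℕ.+ c) ℕ.* (c ℕ.+ c)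
  quadruple = ℕSolver.solve-∀
  quadruple-square : ∀ n → n ℕ.* n ℕ.+ n ℕ.* n ℕ.+ n ℕ.* n ℕ.+ n ℕ.* n ≡ 4 ℕ.* n ℕ.* n
  quadruple-square = ℕSolver.solve-∀

cliffordDivisionᶻ : ∀ X Y .{{_ : NonZero (Nℕ X)}} → ck′ (X *ᶻ transposeᶻ Y) ≡ 0ℤ →
  ∃ λ Q → ck′ Q ≡ 0ℤ × Nℕ (Y -ᶻ X *ᶻ Q) < Nℕ X
cliffordDivisionᶻ X Y XYᵀ-vector = Q , refl ,
  m*w≡sum-of-three-squares⇒w<m {a = ∣ re′ E ∣} {∣ ci′ E ∣} {∣ cj′ E ∣} key
    (proj₂ (approximate (re′ Z))) (proj₂ (approximate (ci′ Z))) (proj₂ (approximate (cj′ Z)))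
  where
  m : ℕ
  m = Nℕ X
  Z : ℤQuat
  Z = conjᶻ X *ᶻ Y
  approximate : ∀ z → ∃ λ q → ∣ z ℤ.- + m ℤ.* q ∣ ℕ.+ ∣ z ℤ.- + m ℤ.* q ∣ ≤ m
  approximate z = nearestMultiple z m
  Q W E : ℤQuat
  Q = ⟨ proj₁ (approximate (re′ Z)) , proj₁ (approximate (ci′ Z)) , proj₁ (approximate (cj′ Z)) , 0ℤ ⟩
  W = Y -ᶻ X *ᶻ Q
  E = Z -ᶻ + m ·ᶻ Q

  E-vector : ck′ E ≡ 0ℤ
  E-vector = cong₂ (λ z w → z ℤ.+ ℤ.- w) (trans (ck′-conjᶻ-*ᶻ X Y) (cong ℤ.-_ XYᵀ-vector)) (ℤP.*-zeroʳ (+ m))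

  key : m ℕ.* Nℕ W ≡ ∣ re′ E ∣ ℕ.* ∣ re′ E ∣ ℕ.+ ∣ ci′ E ∣ ℕ.* ∣ ci′ E ∣ ℕ.+ ∣ cj′ E ∣ ℕ.* ∣ cj′ E ∣
  key = begin
    m ℕ.* Nℕ W             ≡⟨ cong (ℕ._* Nℕ W) (Nℕ-conjᶻ X) ⟨
    Nℕ (conjᶻ X) ℕ.* Nℕ W  ≡⟨ Nℕ-*ᶻ (conjᶻ X) W ⟨
    Nℕ (conjᶻ X *ᶻ W)      ≡⟨ cong Nℕ (conjᶻ-*ᶻ-remainder X Y Q) ⟩
    Nℕ (Z -ᶻ Nᶻ X ·ᶻ Q)    ≡⟨ cong (λ n → Nℕ (Z -ᶻ n ·ᶻ Q)) (Nᶻ≡+Nℕ X) ⟩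
    Nℕ E                   ≡⟨ Nℕ-vector E E-vector ⟩
    ∣ re′ E ∣ ℕ.* ∣ re′ E ∣ ℕ.+ ∣ ci′ E ∣ ℕ.* ∣ ci′ E ∣ ℕ.+ ∣ cj′ E ∣ ℕ.* ∣ cj′ E ∣ ∎
    where open ≡-Reasoning

ℚ-ring : AlmostCommutativeRing 0ℓ 0ℓ
ℚ-ring = fromCommutativeRing ℚP.+-*-commutativeRing (λ x → dec⇒maybe (0ℚ ℚP.≟ x))

module ℚ-QuaternionSolver = QuaternionSolver ℚ-ring

ι : ℤ → ℚ
ι a = a / 1

toℚᵘ-ι : ∀ a → toℚᵘ (ι a) ≃ᵘ mkℚᵘ a 0
toℚᵘ-ι a = ℚP.toℚᵘ-fromℚᵘ (mkℚᵘ a 0)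

ι-+ : ∀ a b → ι (a ℤ.+ b) ≡ ι a ℚ.+ ι b
ι-+ a b = ℚP.toℚᵘ-injective (begin
  toℚᵘ (ι (a ℤ.+ b))          ≈⟨ toℚᵘ-ι (a ℤ.+ b) ⟩
  mkℚᵘ (a ℤ.+ b) 0            ≈⟨ *≡* (sum-over-1 a b) ⟩
  mkℚᵘ a 0 ℚᵘ.+ mkℚᵘ b 0       ≈⟨ ℚᵘP.+-cong (toℚᵘ-ι a) (toℚᵘ-ι b) ⟨
  toℚᵘ (ι a) ℚᵘ.+ toℚᵘ (ι b)   ≈⟨ ℚP.toℚᵘ-homo-+ (ι a) (ι b) ⟨
  toℚᵘ (ι a ℚ.+ ι b)          ∎)
  where
  open ℚᵘP.≃-Reasoning
  sum-over-1 : ∀ a b → (a ℤ.+ b) ℤ.* + 1 ≡ (a ℤ.* + 1 ℤ.+ b ℤ.* + 1) ℤ.* + 1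
  sum-over-1 = ℤSolver.solve-∀

ι-* : ∀ a b → ι (a ℤ.* b) ≡ ι a ℚ.* ι b
ι-* a b = ℚP.toℚᵘ-injective (begin
  toℚᵘ (ι (a ℤ.* b))          ≈⟨ toℚᵘ-ι (a ℤ.* b) ⟩
  mkℚᵘ (a ℤ.* b) 0            ≈⟨ *≡* refl ⟩
  mkℚᵘ a 0 ℚᵘ.* mkℚᵘ b 0       ≈⟨ ℚᵘP.*-cong (toℚᵘ-ι a) (toℚᵘ-ι b) ⟨
  toℚᵘ (ι a) ℚᵘ.* toℚᵘ (ι b)   ≈⟨ ℚP.toℚᵘ-homo-* (ι a) (ι b) ⟨
  toℚᵘ (ι a ℚ.* ι b)          ∎)
  where open ℚᵘP.≃-Reasoning

ι-neg : ∀ a → ι (ℤ.- a) ≡ ℚ.- ι a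
ι-neg a = ℚP.toℚᵘ-injective (begin
  toℚᵘ (ι (ℤ.- a))  ≈⟨ toℚᵘ-ι (ℤ.- a) ⟩
  mkℚᵘ (ℤ.- a) 0    ≈⟨ ℚᵘP.-‿cong (toℚᵘ-ι a) ⟨
  ℚᵘ.- toℚᵘ (ι a)    ≈⟨ ℚP.toℚᵘ-homo‿- (ι a) ⟨
  toℚᵘ (ℚ.- ι a)    ∎)
  where open ℚᵘP.≃-Reasoning

ι-injective : ∀ {a b} → ι a ≡ ι b → a ≡ b
ι-injective {a} {b} eq with ℚᵘP.≃-trans (ℚᵘP.≃-sym (toℚᵘ-ι a)) (ℚᵘP.≃-trans (ℚP.toℚᵘ-cong eq) (toℚᵘ-ι b))
... | *≡* a*1≡b*1 = trans (sym (ℤP.*-identityʳ a)) (trans a*1≡b*1 (ℤP.*-identityʳ b))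

ι-mono-< : ∀ {a b} → a ℤ.< b → ι a ℚ.< ι b
ι-mono-< {a} {b} a<b = ℚP.toℚᵘ-cancel-<
  (ℚᵘP.<-respʳ-≃ (ℚᵘP.≃-sym (toℚᵘ-ι b)) (ℚᵘP.<-respˡ-≃ (ℚᵘP.≃-sym (toℚᵘ-ι a))
    (*<* (subst₂ ℤ._<_ (sym (ℤP.*-identityʳ a)) (sym (ℤP.*-identityʳ b)) a<b))))

ι-cancel-< : ∀ {a b} → ι a ℚ.< ι b → a ℤ.< b
ι-cancel-< {a} {b} ιa<ιb with ℚᵘP.<-respʳ-≃ (toℚᵘ-ι b) (ℚᵘP.<-respˡ-≃ (toℚᵘ-ι a) (ℚP.toℚᵘ-mono-< ιa<ιb))
... | *<* a*1<b*1 = subst₂ ℤ._<_ (ℤP.*-identityʳ a) (ℤP.*-identityʳ b) a*1<b*1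

*-cancelʳ-≡-pos : ∀ {p q} r .{{_ : Positive r}} → p ℚ.* r ≡ q ℚ.* r → p ≡ q
*-cancelʳ-≡-pos r eq =
  ℚP.≤-antisym (ℚP.*-cancelʳ-≤-pos r (ℚP.≤-reflexive eq)) (ℚP.*-cancelʳ-≤-pos r (ℚP.≤-reflexive (sym eq)))

ι*-≡0 : ∀ {k} r .{{_ : Positive r}} → ι k ℚ.* r ≡ 0ℚ → k ≡ 0ℤ
ι*-≡0 r eq = ι-injective (*-cancelʳ-≡-pos r (trans eq (sym (ℚP.*-zeroˡ r))))

ι*-mono-< : ∀ {k l} r .{{_ : Positive r}} → k ℤ.< l → ι k ℚ.* r ℚ.< ι l ℚ.* r
ι*-mono-< r = ℚP.*-monoˡ-<-pos r ∘ ι-mono-<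

ι*-cancel-< : ∀ {k l} r .{{_ : Positive r}} → ι k ℚ.* r ℚ.< ι l ℚ.* r → k ℤ.< l
ι*-cancel-< r = ι-cancel-< ∘ ℚP.*-cancelʳ-<-nonNeg r {{ℚP.pos⇒nonNeg r}}

ι*-+ : ∀ s a b → ι (a ℤ.+ b) ℚ.* s ≡ ι a ℚ.* s ℚ.+ ι b ℚ.* s
ι*-+ s a b = trans (cong (ℚ._* s) (ι-+ a b)) (ℚP.*-distribʳ-+ s (ι a) (ι b))

ι*-neg : ∀ s a → ι (ℤ.- a) ℚ.* s ≡ ℚ.- (ι a ℚ.* s)
ι*-neg s a = trans (cong (ℚ._* s) (ι-neg a)) (sym (ℚP.neg-distribˡ-* (ι a) s))

quat-ext : ∀ {a b c d a′ b′ c′ d′} → a ≡ a′ → b ≡ b′ → c ≡ c′ → d ≡ d′ → quat a b c d ≡ quat a′ b′ c′ d′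
quat-ext refl refl refl refl = refl

embed : ℚ → ℤQuat → Quat
embed s ⟨ a , b , c , d ⟩ = quat (ι a ℚ.* s) (ι b ℚ.* s) (ι c ℚ.* s) (ι d ℚ.* s)

embed-*Q : ∀ s t X Y → embed s X *Q embed t Y ≡ embed (s ℚ.* t) (X *ᶻ Y)
embed-*Q s t ⟨ a , b , c , d ⟩ ⟨ e , f , g , h ⟩ = sym (quat-ext
  (sum₄ (a ℤ.* e) (ℤ.- (b ℤ.* f)) (ℤ.- (c ℤ.* g)) (ℤ.- (d ℤ.* h)) (term a e) (−term b f) (−term c g) (−term d h))
  (sum₄ (a ℤ.* f) (b ℤ.* e) (c ℤ.* h) (ℤ.- (d ℤ.* g)) (term a f) (term b e) (term c h) (−term d g))
  (sum₄ (a ℤ.* g) (ℤ.- (b ℤ.* h)) (c ℤ.* e) (d ℤ.* f) (term a g) (−term b h) (term c e) (term d f))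
  (sum₄ (a ℤ.* h) (b ℤ.* g) (ℤ.- (c ℤ.* f)) (d ℤ.* e) (term a h) (term b g) (−term c f) (term d e)))
  where
  w : ℚ
  w = s ℚ.* t
  rearrange : ∀ x y s t → x ℚ.* y ℚ.* (s ℚ.* t) ≡ x ℚ.* s ℚ.* (y ℚ.* t)
  rearrange = solve-∀ ℚ-ring
  term : ∀ x y → ι (x ℤ.* y) ℚ.* w ≡ ι x ℚ.* s ℚ.* (ι y ℚ.* t)
  term x y = trans (cong (ℚ._* w) (ι-* x y)) (rearrange (ι x) (ι y) s t)
  −term : ∀ x y → ι (ℤ.- (x ℤ.* y)) ℚ.* w ≡ ℚ.- (ι x ℚ.* s ℚ.* (ι y ℚ.* t))
  −term x y = trans (ι*-neg w (x ℤ.* y)) (cong ℚ.-_ (term x y))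
  sum₄ : ∀ p q r u {p′ q′ r′ u′} → ι p ℚ.* w ≡ p′ → ι q ℚ.* w ≡ q′ → ι r ℚ.* w ≡ r′ → ι u ℚ.* w ≡ u′ →
         ι (p ℤ.+ q ℤ.+ r ℤ.+ u) ℚ.* w ≡ p′ ℚ.+ q′ ℚ.+ r′ ℚ.+ u′
  sum₄ p q r u refl refl refl refl = trans (ι*-+ w (p ℤ.+ q ℤ.+ r) u)
    (cong (ℚ._+ ι u ℚ.* w) (trans (ι*-+ w (p ℤ.+ q) r) (cong (ℚ._+ ι r ℚ.* w) (ι*-+ w p q))))

embed-+Q : ∀ s X Y → embed s X +Q embed s Y ≡ embed s (X +ᶻ Y)
embed-+Q s ⟨ a , b , c , d ⟩ ⟨ e , f , g , h ⟩ = sym (quat-ext (ι*-+ s a e) (ι*-+ s b f) (ι*-+ s c g) (ι*-+ s d h))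

embed-conj : ∀ s X → conj (embed s X) ≡ embed s (conjᶻ X)
embed-conj s ⟨ a , b , c , d ⟩ = sym (quat-ext refl (ι*-neg s b) (ι*-neg s c) (ι*-neg s d))

embed-transpose : ∀ s X → transpose (embed s X) ≡ embed s (transposeᶻ X)
embed-transpose s ⟨ a , b , c , d ⟩ = sym (quat-ext refl refl refl (ι*-neg s d))

embed-0ᶻ : ∀ s → embed s 0ᶻ ≡ 0Q
embed-0ᶻ s = quat-ext (ℚP.*-zeroˡ s) (ℚP.*-zeroˡ s) (ℚP.*-zeroˡ s) (ℚP.*-zeroˡ s)

embed-≡0ᶻ : ∀ s {X} → X ≡ 0ᶻ → embed s X ≡ 0Q
embed-≡0ᶻ s refl = embed-0ᶻ s

embed≡0Q⇒≡0ᶻ : ∀ s .{{_ : Positive s}} X → embed s X ≡ 0Q → X ≡ 0ᶻ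
embed≡0Q⇒≡0ᶻ s ⟨ a , b , c , d ⟩ eq =
  quaternion-ext (ι*-≡0 s (cong re eq)) (ι*-≡0 s (cong ci eq)) (ι*-≡0 s (cong cj eq)) (ι*-≡0 s (cong ck eq))

re′-*ᶻ-conjᶻ : ∀ X → re′ (X *ᶻ conjᶻ X) ≡ Nᶻ X
re′-*ᶻ-conjᶻ ⟨ a , b , c , d ⟩ =
  solve 4 (λ a b c d → re′ (⟨ a , b , c , d ⟩ *ᴴ conjᴴ ⟨ a , b , c , d ⟩) ⊜ Nᴴ ⟨ a , b , c , d ⟩) refl a b c d
  where open ℤ-QuaternionSolver

N-embed : ∀ s X → N (embed s X) ≡ ι (+ Nℕ X) ℚ.* (s ℚ.* s)
N-embed s X = begin
  N (embed s X)                        ≡⟨ cong (λ y → re (embed s X *Q y)) (embed-conj s X) ⟩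
  re (embed s X *Q embed s (conjᶻ X))  ≡⟨ cong re (embed-*Q s s X (conjᶻ X)) ⟩
  ι (re′ (X *ᶻ conjᶻ X)) ℚ.* (s ℚ.* s) ≡⟨ cong (λ k → ι k ℚ.* (s ℚ.* s)) (trans (re′-*ᶻ-conjᶻ X) (Nᶻ≡+Nℕ X)) ⟩
  ι (+ Nℕ X) ℚ.* (s ℚ.* s)             ∎
  where open ≡-Reasoning

embed-N≡0⇒≡0Q : ∀ s .{{_ : Positive s}} X → N (embed s X) ≡ 0ℚ → embed s X ≡ 0Q
embed-N≡0⇒≡0Q s X NX≡0 = embed-≡0ᶻ s (Nℕ≡0⇒≡0ᶻ X (ℤP.+-injective
  (ι*-≡0 (s ℚ.* s) {{ℚP.pos*pos⇒pos s s}} (trans (sym (N-embed s X)) NX≡0))))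

embed-noZeroDivisors : ∀ s .{{_ : Positive s}} X Y → embed s X *Q embed s Y ≡ 0Q → embed s X ≡ 0Q ⊎ embed s Y ≡ 0Q
embed-noZeroDivisors s X Y XY≡0 = Sum.map (embed-≡0ᶻ s) (embed-≡0ᶻ s)
  (*ᶻ≡0ᶻ⇒≡0ᶻ X Y (embed≡0Q⇒≡0ᶻ (s ℚ.* s) {{ℚP.pos*pos⇒pos s s}} (X *ᶻ Y) (trans (sym (embed-*Q s s X Y)) XY≡0)))

-- The Clifford monoid

*Q-conj-InQ : ∀ x → InQ (x *Q conj x)
*Q-conj-InQ (quat a b c d) = quat-ext refl
  (solve 4 (λ a b c d → ci′ (⟨ a , b , c , d ⟩ *ᴴ conjᴴ ⟨ a , b , c , d ⟩) ⊜ Κ 0ℚ) refl a b c d)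
  (solve 4 (λ a b c d → cj′ (⟨ a , b , c , d ⟩ *ᴴ conjᴴ ⟨ a , b , c , d ⟩) ⊜ Κ 0ℚ) refl a b c d)
  (solve 4 (λ a b c d → ck′ (⟨ a , b , c , d ⟩ *ᴴ conjᴴ ⟨ a , b , c , d ⟩) ⊜ Κ 0ℚ) refl a b c d)
  where open ℚ-QuaternionSolver

transpose-conjugation-IsVec : ∀ x v → IsVec v → IsVec (x *Q v *Q transpose x)
transpose-conjugation-IsVec (quat a b c d) (quat u v w _) refl =
  solve 7 (λ a b c d u v w → ck′ (⟨ a , b , c , d ⟩ *ᴴ ⟨ u , v , w , Κ 0ℚ ⟩ *ᴴ transposeᴴ ⟨ a , b , c , d ⟩) ⊜ Κ 0ℚ)
    refl a b c d u v w
  where open ℚ-QuaternionSolver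

∈⇒Mon : ∀ {R : Subset} x → R x → Mon R x
∈⇒Mon x x∈R = x∈R , *Q-conj-InQ x , transpose-conjugation-IsVec x

-- Orders that are scaled integral lattices

scalar-embed : ∀ a → scalar (ι a) ≡ embed 1ℚ (scalarᶻ a)
scalar-embed a = quat-ext (sym (ℚP.*-identityʳ (ι a))) refl refl refl

ZSpan-embed : ∀ s E₁ E₂ E₃ E₄ a b c d →
  scalar (ι a) *Q embed s E₁ +Q scalar (ι b) *Q embed s E₂ +Q scalar (ι c) *Q embed s E₃ +Q scalar (ι d) *Q embed s E₄
    ≡ embed s (combinationᶻ E₁ E₂ E₃ E₄ ⟨ a , b , c , d ⟩)
ZSpan-embed s E₁ E₂ E₃ E₄ a b c d = begin
  scalar (ι a) *Q embed s E₁ +Q scalar (ι b) *Q embed s E₂ +Q scalar (ι c) *Q embed s E₃ +Q scalar (ι d) *Q embed s E₄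
    ≡⟨ cong₂ _+Q_ (cong₂ _+Q_ (cong₂ _+Q_ (scaled a E₁) (scaled b E₂)) (scaled c E₃)) (scaled d E₄) ⟩
  embed s A₁ +Q embed s A₂ +Q embed s A₃ +Q embed s A₄
    ≡⟨ cong (λ x → x +Q embed s A₃ +Q embed s A₄) (embed-+Q s A₁ A₂) ⟩
  embed s (A₁ +ᶻ A₂) +Q embed s A₃ +Q embed s A₄
    ≡⟨ cong (_+Q embed s A₄) (embed-+Q s (A₁ +ᶻ A₂) A₃) ⟩
  embed s (A₁ +ᶻ A₂ +ᶻ A₃) +Q embed s A₄
    ≡⟨ embed-+Q s (A₁ +ᶻ A₂ +ᶻ A₃) A₄ ⟩
  embed s (A₁ +ᶻ A₂ +ᶻ A₃ +ᶻ A₄) ∎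
  where
  open ≡-Reasoning
  A₁ A₂ A₃ A₄ : ℤQuat
  A₁ = scalarᶻ a *ᶻ E₁
  A₂ = scalarᶻ b *ᶻ E₂
  A₃ = scalarᶻ c *ᶻ E₃
  A₄ = scalarᶻ d *ᶻ E₄
  scaled : ∀ k E → scalar (ι k) *Q embed s E ≡ embed s (scalarᶻ k *ᶻ E)
  scaled k E = begin
    scalar (ι k) *Q embed s E          ≡⟨ cong (_*Q embed s E) (scalar-embed k) ⟩
    embed 1ℚ (scalarᶻ k) *Q embed s E  ≡⟨ embed-*Q 1ℚ s (scalarᶻ k) E ⟩
    embed (1ℚ ℚ.* s) (scalarᶻ k *ᶻ E)  ≡⟨ cong (λ t → embed t (scalarᶻ k *ᶻ E)) (ℚP.*-identityˡ s) ⟩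
    embed s (scalarᶻ k *ᶻ E)           ∎

Span : ℚ → (E₁ E₂ E₃ E₄ : ℤQuat) → Subset
Span s E₁ E₂ E₃ E₄ = ZSpan (embed s E₁) (embed s E₂) (embed s E₃) (embed s E₄)

Span-coordinates : ∀ s E₁ E₂ E₃ E₄ {x} → Span s E₁ E₂ E₃ E₄ x → ∃ λ B → x ≡ embed s (combinationᶻ E₁ E₂ E₃ E₄ B)
Span-coordinates s E₁ E₂ E₃ E₄ (a , b , c , d , x≡) = ⟨ a , b , c , d ⟩ , trans x≡ (ZSpan-embed s E₁ E₂ E₃ E₄ a b c d)

Span-member : ∀ s E₁ E₂ E₃ E₄ B → Span s E₁ E₂ E₃ E₄ (embed s (combinationᶻ E₁ E₂ E₃ E₄ B))
Span-member s E₁ E₂ E₃ E₄ ⟨ a , b , c , d ⟩ = a , b , c , d , sym (ZSpan-embed s E₁ E₂ E₃ E₄ a b c d)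

LipschitzSpan : Subset
LipschitzSpan = Span 1ℚ 1ᶻ iᶻ jᶻ kᶻ

Lipschitz≡LipschitzSpan : Lipschitz ≡ LipschitzSpan
Lipschitz≡LipschitzSpan = refl

lipschitzᶻ≡id : ∀ X → lipschitzᶻ X ≡ X
lipschitzᶻ≡id ⟨ a , b , c , d ⟩ = quaternion-ext
  (solve 4 (λ a b c d → re′ (lipschitzᴴ ⟨ a , b , c , d ⟩) ⊜ a) refl a b c d)
  (solve 4 (λ a b c d → ci′ (lipschitzᴴ ⟨ a , b , c , d ⟩) ⊜ b) refl a b c d)
  (solve 4 (λ a b c d → cj′ (lipschitzᴴ ⟨ a , b , c , d ⟩) ⊜ c) refl a b c d)
  (solve 4 (λ a b c d → ck′ (lipschitzᴴ ⟨ a , b , c , d ⟩) ⊜ d) refl a b c d)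
  where open ℤ-QuaternionSolver

LipschitzSpan-embed : ∀ X → LipschitzSpan (embed 1ℚ X)
LipschitzSpan-embed X = subst (LipschitzSpan ∘ embed 1ℚ) (lipschitzᶻ≡id X) (Span-member 1ℚ 1ᶻ iᶻ jᶻ kᶻ X)

LipschitzSpan-coordinates : ∀ {x} → LipschitzSpan x → ∃ λ X → x ≡ embed 1ℚ X
LipschitzSpan-coordinates {x} x∈L = B , trans x≡ (cong (embed 1ℚ) (lipschitzᶻ≡id B))
  where
  B : ℤQuat
  B = proj₁ (Span-coordinates 1ℚ 1ᶻ iᶻ jᶻ kᶻ x∈L)
  x≡ : x ≡ embed 1ℚ (combinationᶻ 1ᶻ iᶻ jᶻ kᶻ B)
  x≡ = proj₂ (Span-coordinates 1ℚ 1ᶻ iᶻ jᶻ kᶻ x∈L)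

RemainderClosed : (ℤQuat → ℤQuat) → Set
RemainderClosed f = ∀ B C Q → ck′ Q ≡ 0ℤ → ∃ λ D → f D ≡ f C -ᶻ f B *ᶻ Q

record ScaledLattice (R : Subset) : Set where
  field
    scale : ℚ
    {{scale-positive}} : Positive scale
    coordinates : ℤQuat → ℤQuat
    coordinatesOf : ∀ {x} → R x → ∃ λ B → x ≡ embed scale (coordinates B)
    member : ∀ B → R (embed scale (coordinates B))
    remainderClosed : RemainderClosed coordinates
    LipschitzSpan⊆ : ∀ {x} → LipschitzSpan x → R x

module _ {R : Subset} (L : ScaledLattice R) where
  open ScaledLattice L

  private instance
    scale²-positive : Positive (scale ℚ.* scale)
    scale²-positive = ℚP.pos*pos⇒pos scale scale

  N≡0⇒≡0Q : ∀ {x} → R x → N x ≡ 0ℚ → x ≡ 0Q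
  N≡0⇒≡0Q {x} x∈R Nx≡0 = trans x≡ (embed-N≡0⇒≡0Q scale X (trans (cong N (sym x≡)) Nx≡0))
    where
    X : ℤQuat
    X = coordinates (proj₁ (coordinatesOf x∈R))
    x≡ : x ≡ embed scale X
    x≡ = proj₂ (coordinatesOf x∈R)

  noZeroDivisors : ∀ {x y} → R x → R y → x *Q y ≡ 0Q → x ≡ 0Q ⊎ y ≡ 0Q
  noZeroDivisors {x} {y} x∈R y∈R xy≡0 =
    Sum.map (trans x≡) (trans y≡) (embed-noZeroDivisors scale X Y (trans (cong₂ _*Q_ (sym x≡) (sym y≡)) xy≡0))
    where
    X Y : ℤQuat
    X = coordinates (proj₁ (coordinatesOf x∈R))
    Y = coordinates (proj₁ (coordinatesOf y∈R))
    x≡ : x ≡ embed scale X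
    x≡ = proj₂ (coordinatesOf x∈R)
    y≡ : y ≡ embed scale Y
    y≡ = proj₂ (coordinatesOf y∈R)

  N≡0⇔zeroDivisor : ∀ x → R x → (N x ≡ 0ℚ ⇔ ZeroDivisor R x)
  N≡0⇔zeroDivisor x x∈R = mk⇔ zeroDivisor Nx≡0
    where
    zeroDivisor : N x ≡ 0ℚ → ZeroDivisor R x
    zeroDivisor Nx≡0 =
      embed 1ℚ 1ᶻ , LipschitzSpan⊆ (LipschitzSpan-embed 1ᶻ) , (λ ()) , inj₁ (cong (_*Q embed 1ℚ 1ᶻ) (N≡0⇒≡0Q x∈R Nx≡0))
    N0Q≡0 : ∀ {x} → x ≡ 0Q → N x ≡ 0ℚ
    N0Q≡0 refl = refl
    Nx≡0 : ZeroDivisor R x → N x ≡ 0ℚ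
    Nx≡0 (y , y∈R , y≢0 , inj₁ xy≡0) = Sum.[ N0Q≡0 , ⊥-elim ∘ y≢0 ]′ (noZeroDivisors x∈R y∈R xy≡0)
    Nx≡0 (y , y∈R , y≢0 , inj₂ yx≡0) = Sum.[ ⊥-elim ∘ y≢0 , N0Q≡0 ]′ (noZeroDivisors y∈R x∈R yx≡0)

  rightDivision : ∀ x y → Mon R x → Mon R y → 0ℚ ℚ.< N x → VecOf R (x *Q transpose y) →
    Σ Quat λ q → Σ Quat λ r → VecOf R q × Mon R r × (y ≡ x *Q q +Q r) × (N r ℚ.< N x)
  rightDivision x y (x∈R , _) (y∈R , _) 0<Nx (_ , xyᵀ∈Vec) =
    embed 1ℚ Q , embed scale (coordinates D) , (LipschitzSpan⊆ (LipschitzSpan-embed Q) , q∈Vec) ,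
    ∈⇒Mon {R} (embed scale (coordinates D)) (member D) , y≡xq+r , Nr<Nx
    where
    σ : ℚ
    σ = scale ℚ.* scale
    B C X Y : ℤQuat
    B = proj₁ (coordinatesOf x∈R)
    C = proj₁ (coordinatesOf y∈R)
    X = coordinates B
    Y = coordinates C
    x≡ : x ≡ embed scale X
    x≡ = proj₂ (coordinatesOf x∈R)
    y≡ : y ≡ embed scale Y
    y≡ = proj₂ (coordinatesOf y∈R)

    Nx≡ : N x ≡ ι (+ Nℕ X) ℚ.* σ
    Nx≡ = trans (cong N x≡) (N-embed scale X)

    NX≢0 : NonZero (Nℕ X)
    NX≢0 = ℕ.>-nonZero (ℤP.drop‿+<+ (ι*-cancel-< {0ℤ} {+ Nℕ X} σ (subst₂ ℚ._<_ (sym (ℚP.*-zeroˡ σ)) Nx≡ 0<Nx)))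

    XYᵀ-vector : ck′ (X *ᶻ transposeᶻ Y) ≡ 0ℤ
    XYᵀ-vector = ι*-≡0 {ck′ (X *ᶻ transposeᶻ Y)} σ (trans (sym (cong ck xyᵀ≡)) xyᵀ∈Vec)
      where
      xyᵀ≡ : x *Q transpose y ≡ embed σ (X *ᶻ transposeᶻ Y)
      xyᵀ≡ = trans (cong₂ (λ u v → u *Q transpose v) x≡ y≡)
                   (trans (cong (embed scale X *Q_) (embed-transpose scale Y)) (embed-*Q scale scale X (transposeᶻ Y)))

    division : ∃ λ Q → ck′ Q ≡ 0ℤ × Nℕ (Y -ᶻ X *ᶻ Q) < Nℕ X
    division = cliffordDivisionᶻ X Y {{NX≢0}} XYᵀ-vector
    Q W : ℤQuat
    Q = proj₁ division
    W = Y -ᶻ X *ᶻ Q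
    closure : ∃ λ D → coordinates D ≡ W
    closure = remainderClosed B C Q (proj₁ (proj₂ division))
    D : ℤQuat
    D = proj₁ closure

    q∈Vec : IsVec (embed 1ℚ Q)
    q∈Vec = cong (λ k → ι k ℚ.* 1ℚ) (proj₁ (proj₂ division))

    y≡xq+r : y ≡ x *Q embed 1ℚ Q +Q embed scale (coordinates D)
    y≡xq+r = begin
      y                                               ≡⟨ y≡ ⟩
      embed scale Y                                   ≡⟨ cong (embed scale) (X+ᶻ[Y-ᶻX]≡Y (X *ᶻ Q) Y) ⟨
      embed scale (X *ᶻ Q +ᶻ W)                       ≡⟨ embed-+Q scale (X *ᶻ Q) W ⟨
      embed scale (X *ᶻ Q) +Q embed scale W           ≡⟨ cong₂ _+Q_ xq≡ (cong (embed scale) (proj₂ closure)) ⟨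
      x *Q embed 1ℚ Q +Q embed scale (coordinates D)  ∎
      where
      open ≡-Reasoning
      xq≡ : x *Q embed 1ℚ Q ≡ embed scale (X *ᶻ Q)
      xq≡ = trans (cong (_*Q embed 1ℚ Q) x≡)
                  (trans (embed-*Q scale 1ℚ X Q) (cong (λ t → embed t (X *ᶻ Q)) (ℚP.*-identityʳ scale)))

    Nr<Nx : N (embed scale (coordinates D)) ℚ.< N x
    Nr<Nx = begin-strict
      N (embed scale (coordinates D))  ≡⟨ cong (N ∘ embed scale) (proj₂ closure) ⟩
      N (embed scale W)                ≡⟨ N-embed scale W ⟩
      ι (+ Nℕ W) ℚ.* σ                 <⟨ ι*-mono-< {+ Nℕ W} {+ Nℕ X} σ (ℤ.+<+ (proj₂ (proj₂ division))) ⟩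
      ι (+ Nℕ X) ℚ.* σ                 ≡⟨ Nx≡ ⟨
      N x                              ∎
      where open ℚP.≤-Reasoning

  rightCliffordEuclidean : RightCliffordEuclidean R N
  rightCliffordEuclidean = N≡0⇔zeroDivisor , rightDivision

-- The Lipschitz and Hurwitz orders

lipschitz-remainderClosed : RemainderClosed lipschitzᶻ
lipschitz-remainderClosed B C Q _ = C -ᶻ B *ᶻ Q ,
  trans (lipschitzᶻ≡id _) (sym (cong₂ (λ U V → U -ᶻ V *ᶻ Q) (lipschitzᶻ≡id C) (lipschitzᶻ≡id B)))

lipschitzLattice : ScaledLattice LipschitzSpan
lipschitzLattice = record
  { scale = 1ℚ
  ; coordinates = combinationᶻ 1ᶻ iᶻ jᶻ kᶻ
  ; coordinatesOf = Span-coordinates 1ℚ 1ᶻ iᶻ jᶻ kᶻ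
  ; member = Span-member 1ℚ 1ᶻ iᶻ jᶻ kᶻ
  ; remainderClosed = lipschitz-remainderClosed
  ; LipschitzSpan⊆ = id
  }

HurwitzSpan : Subset
HurwitzSpan = Span ½ (1ᶻ +ᶻ 1ᶻ) (iᶻ +ᶻ iᶻ) (jᶻ +ᶻ jᶻ) ωᶻ

Hurwitz≡HurwitzSpan : Hurwitz ≡ HurwitzSpan
Hurwitz≡HurwitzSpan = refl

hurwitzᶻ-remainder : ∀ B C p q r →
  hurwitzᶻ (C -ᶻ hurwitz-*-vectorᶻ B ⟨ p , q , r , 0ℤ ⟩) ≡ hurwitzᶻ C -ᶻ hurwitzᶻ B *ᶻ ⟨ p , q , r , 0ℤ ⟩
hurwitzᶻ-remainder ⟨ a , b , c , d ⟩ ⟨ e , f , g , h ⟩ p q r = quaternion-ext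
  (solve 11 (λ a b c d e f g h p q r → re′ (lhs a b c d e f g h p q r) ⊜ re′ (rhs a b c d e f g h p q r))
     refl a b c d e f g h p q r)
  (solve 11 (λ a b c d e f g h p q r → ci′ (lhs a b c d e f g h p q r) ⊜ ci′ (rhs a b c d e f g h p q r))
     refl a b c d e f g h p q r)
  (solve 11 (λ a b c d e f g h p q r → cj′ (lhs a b c d e f g h p q r) ⊜ cj′ (rhs a b c d e f g h p q r))
     refl a b c d e f g h p q r)
  (solve 11 (λ a b c d e f g h p q r → ck′ (lhs a b c d e f g h p q r) ⊜ ck′ (rhs a b c d e f g h p q r))
     refl a b c d e f g h p q r)
  where
  open ℤ-QuaternionSolver
  lhs rhs : ∀ {n} (a b c d e f g h p q r : Expr ℤ n) → Quaternion (Expr ℤ n)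
  lhs a b c d e f g h p q r = hurwitzᴴ (⟨ e , f , g , h ⟩ -ᴴ hurwitz-*-vectorᴴ ⟨ a , b , c , d ⟩ ⟨ p , q , r , Κ 0ℤ ⟩)
  rhs a b c d e f g h p q r = hurwitzᴴ ⟨ e , f , g , h ⟩ -ᴴ hurwitzᴴ ⟨ a , b , c , d ⟩ *ᴴ ⟨ p , q , r , Κ 0ℤ ⟩

hurwitz-remainderClosed : RemainderClosed hurwitzᶻ
hurwitz-remainderClosed B C ⟨ p , q , r , _ ⟩ refl =
  C -ᶻ hurwitz-*-vectorᶻ B ⟨ p , q , r , 0ℤ ⟩ , hurwitzᶻ-remainder B C p q r

hurwitzᶻ-lipschitz⇒hurwitzᶻ : ∀ X → hurwitzᶻ (lipschitz⇒hurwitzᶻ X) ≡ X +ᶻ X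
hurwitzᶻ-lipschitz⇒hurwitzᶻ ⟨ a , b , c , d ⟩ = quaternion-ext
  (solve 4 (λ a b c d → re′ (hurwitzᴴ (lipschitz⇒hurwitzᴴ ⟨ a , b , c , d ⟩)) ⊜ (a ⊕ a)) refl a b c d)
  (solve 4 (λ a b c d → ci′ (hurwitzᴴ (lipschitz⇒hurwitzᴴ ⟨ a , b , c , d ⟩)) ⊜ (b ⊕ b)) refl a b c d)
  (solve 4 (λ a b c d → cj′ (hurwitzᴴ (lipschitz⇒hurwitzᴴ ⟨ a , b , c , d ⟩)) ⊜ (c ⊕ c)) refl a b c d)
  (solve 4 (λ a b c d → ck′ (hurwitzᴴ (lipschitz⇒hurwitzᴴ ⟨ a , b , c , d ⟩)) ⊜ (d ⊕ d)) refl a b c d)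
  where open ℤ-QuaternionSolver

embed-½-double : ∀ X → embed ½ (X +ᶻ X) ≡ embed 1ℚ X
embed-½-double ⟨ a , b , c , d ⟩ = quat-ext (halve a) (halve b) (halve c) (halve d)
  where
  half-of-double : ∀ x → (x ℚ.+ x) ℚ.* ½ ≡ x ℚ.* 1ℚ
  half-of-double = solve-∀ ℚ-ring
  halve : ∀ k → ι (k ℤ.+ k) ℚ.* ½ ≡ ι k ℚ.* 1ℚ
  halve k = trans (cong (ℚ._* ½) (ι-+ k k)) (half-of-double (ι k))

LipschitzSpan⊆HurwitzSpan : ∀ {x} → LipschitzSpan x → HurwitzSpan x
LipschitzSpan⊆HurwitzSpan {x} x∈L =
  subst HurwitzSpan embed≡x (Span-member ½ (1ᶻ +ᶻ 1ᶻ) (iᶻ +ᶻ iᶻ) (jᶻ +ᶻ jᶻ) ωᶻ (lipschitz⇒hurwitzᶻ X))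
  where
  X : ℤQuat
  X = proj₁ (LipschitzSpan-coordinates x∈L)
  embed≡x : embed ½ (hurwitzᶻ (lipschitz⇒hurwitzᶻ X)) ≡ x
  embed≡x = trans (cong (embed ½) (hurwitzᶻ-lipschitz⇒hurwitzᶻ X))
                  (trans (embed-½-double X) (sym (proj₂ (LipschitzSpan-coordinates x∈L))))

hurwitzLattice : ScaledLattice HurwitzSpan
hurwitzLattice = record
  { scale = ½
  ; coordinates = combinationᶻ (1ᶻ +ᶻ 1ᶻ) (iᶻ +ᶻ iᶻ) (jᶻ +ᶻ jᶻ) ωᶻ
  ; coordinatesOf = Span-coordinates ½ (1ᶻ +ᶻ 1ᶻ) (iᶻ +ᶻ iᶻ) (jᶻ +ᶻ jᶻ) ωᶻ
  ; member = Span-member ½ (1ᶻ +ᶻ 1ᶻ) (iᶻ +ᶻ iᶻ) (jᶻ +ᶻ jᶻ) ωᶻ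
  ; remainderClosed = hurwitz-remainderClosed
  ; LipschitzSpan⊆ = LipschitzSpan⊆HurwitzSpan
  }

mainTheorem19 : CliffordEuclidean Lipschitz N × CliffordEuclidean Hurwitz N
mainTheorem19 =
  inj₁ (subst (λ R → RightCliffordEuclidean R N) (sym Lipschitz≡LipschitzSpan) (rightCliffordEuclidean lipschitzLattice)) ,
  inj₁ (subst (λ R → RightCliffordEuclidean R N) (sym Hurwitz≡HurwitzSpan) (rightCliffordEuclidean hurwitzLattice))
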